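{- Let $f$ and $g$ be the functions defined in the context. Then for every positive integer $n$ and every positive integer $m$, $g(n,m)\leq m-1$; moreover $$0=g(n,1)<1=g(n,2)\leq g(n,3)\leq g(n,4)\leq \ldots$$ and $$g(n,f(n))<f(n)=g(n,f(n)+1)=g(n,f(n)+2)=g(n,f(n)+3)=\ldots$$
   Context: For a positive integer $n$, let $E_n=\{x_k=1,\ x_i+x_j=x_k,\ x_i\cdot x_j=x_k:\ i,j,k\in\{1,\ldots,n\}\}$. Let $f(n)$ denote the smallest non-negative integer $b$ such that for each system $S\subseteq E_n$ which has a solution in non-negative integers $x_1,\ldots,x_n$, there exists a solution of $S$ in non-negative integers not greater than $b$. For tuples $x=(x_1,\ldots,x_n),\ y=(y_1,\ldots,y_n)\in\mathbb{N}^n$, say that $y$ is a duplicate of $x$ if: for all $k$, $x_k=1\Rightarrow y_k=1$; for all $i,j,k$, $x_i+x_j=x_k\Rightarrow y_i+y_j=y_k$; and for all $i,j,k$, $x_i\cdot x_j=x_k\Rightarrow y_i\cdot y_j=y_k$ (indices ranging over $\{1,\ldots,n\}$). For positive integers $n,m$, let $X_m=\{0,1,\ldots,m-1\}$ and call $x\in X_m^n$ removable if there is a duplicate $y\in X_m^n$ of $x$ with $\max(y_1,\ldots,y_n)<\max(x_1,\ldots,x_n)$. Define $g(n,m)$ as the maximum of $\max(x_1,\ldots,x_n)$ over all non-removable $x\in X_m^n$. (This is the number printed on the $m$-th iteration of the paper's infinite MuPAD loop on input $n$: on the $m$-th iteration the loop takes all $n$-tuples from $\{0,\ldots,m-1\}$,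 discards each tuple having a duplicate in the same set with strictly smaller maximum entry, and prints the largest entry among the remaining tuples.) -}

module Defs where

open import Data.Nat using (ℕ; zero; suc; _+_; _*_; _≤_; _⊔_; _≡ᵇ_; _<ᵇ_)
open import Data.Bool using (Bool; true; false; _∧_; _∨_; not)
open import Data.Fin using (Fin)
open import Data.Vec using (Vec; []; _∷_; lookup)
open import Data.List using (List; [_]; map; concatMap; upTo; allFin; filterᵇ; foldr)
open import Data.Bool.ListAction using (all; any)
open import Data.List.Relation.Unary.All using (All)
open import Data.Product using (Σ; _×_)
open import Relation.Binary.PropositionalEquality using (_≡_)

data Eqn (n : ℕ) : Set where
  one : Fin n → Eqn n
  add : Fin n → Fin n → Fin n → Eqn n
  mul : Fin n → Fin n → Fin n → Eqn n

Sat : ∀ {n} → Vec ℕ n → Eqn n → Set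
Sat x (one k)     = lookup x k ≡ 1
Sat x (add i j k) = lookup x i + lookup x j ≡ lookup x k
Sat x (mul i j k) = lookup x i * lookup x j ≡ lookup x k

-- a system S ⊆ E_n (finite, hence given by a list of its equations)
Solves : ∀ {n} → Vec ℕ n → List (Eqn n) → Set
Solves x S = All (Sat x) S

Bounds : ℕ → ℕ → Set
Bounds n b = (S : List (Eqn n)) → Σ (Vec ℕ n) (λ x → Solves x S) →
             Σ (Vec ℕ n) (λ y → Solves y S × Data.Vec.Relation.Unary.All.All (_≤ b) y)
  where import Data.Vec.Relation.Unary.All

-- IsF n b  :⇔  b = f(n)  (the smallest such bound)
IsF : ℕ → ℕ → Set
IsF n b = Bounds n b × ((b' : ℕ) → Bounds n b' → b ≤ b')

tuples : (n m : ℕ) → List (Vec ℕ n)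
tuples zero    m = [ [] ]
tuples (suc n) m = concatMap (λ a → map (a ∷_) (tuples n m)) (upTo m)

maxV : ∀ {n} → Vec ℕ n → ℕ
maxV []       = 0
maxV (a ∷ x)  = a ⊔ maxV x

_⇒ᵇ_ : Bool → Bool → Bool
a ⇒ᵇ b = not a ∨ b

isDuplicate : ∀ {n} → Vec ℕ n → Vec ℕ n → Bool
isDuplicate {n} x y =
  all (λ k → (lookup x k ≡ᵇ 1) ⇒ᵇ (lookup y k ≡ᵇ 1)) (allFin n) ∧
  all (λ i → all (λ j → all (λ k →
      ((lookup x i + lookup x j ≡ᵇ lookup x k) ⇒ᵇ (lookup y i + lookup y j ≡ᵇ lookup y k)) ∧
      ((lookup x i * lookup x j ≡ᵇ lookup x k) ⇒ᵇ (lookup y i * lookup y j ≡ᵇ lookup y k)))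
    (allFin n)) (allFin n)) (allFin n)

removable : (n m : ℕ) → Vec ℕ n → Bool
removable n m x = any (λ y → isDuplicate x y ∧ (maxV y <ᵇ maxV x)) (tuples n m)

g : ℕ → ℕ → ℕ
g n m = foldr _⊔_ 0 (map maxV (filterᵇ (λ x → not (removable n m x)) (tuples n m)))

-- Whether a tuple is removable (has a duplicate with smaller maximum) does not depend on m
-- once the tuple lies in X_m^n; hence g is monotone in m, and the all-ones tuple, whose
-- duplicates all contain a 1, is never removable, so g(n,2) = 1. Taking for S the equations
-- satisfied by x shows that b bounds all solvable systems iff every tuple has a duplicate
-- with maximum ≤ b. So for b = f(n) < m, every non-removable tuple has maximum ≤ b, i.e.
-- g(n,m) ≤ b; and descending along duplicates with smaller maximum, every tuple has a
-- non-removable duplicate with maximum ≤ b, which lies in X_m^n, so g(n,m) is itself a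
-- bound and b ≤ g(n,m) by minimality of f(n).
module Submission where

open import Defs
open import Data.Nat using (ℕ; suc; _+_; _∸_; _≤_; _<_)
open import Data.Product using (_×_)
open import Relation.Binary.PropositionalEquality using (_≡_)

open import Data.Bool using (Bool; true; false; not; T; T?; _∧_)
open import Data.Bool.ListAction using (all; any)
open import Data.Bool.Properties using (T-∧)
open import Data.Fin as Fin using (Fin)
open import Data.List using (List; []; _∷_; foldr; _++_; filter; allFin; concatMap; map; upTo)
open import Data.List.Membership.Propositional using (_∈_; find; lose)
open import Data.List.Membership.Propositional.Properties
open import Data.List.Relation.Unary.All as All using (All)
open import Data.List.Relation.Unary.All.Properties using (all⁺; all⁻; all-filter; map⁺)
open import Data.List.Relation.Unary.Any using (here; there)
open import Data.List.Relation.Unary.Any.Properties using (any⁺; any⁻)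
open import Data.Nat using (NonZero; >-nonZero; z≤n; s≤s; _*_; _⊔_; _≡ᵇ_; _<ᵇ_)
open import Data.Nat.Properties
open import Data.Product using (∃-syntax; _,_; proj₁; proj₂)
open import Data.Unit using (tt)
open import Data.Vec using (Vec; []; _∷_; lookup; replicate)
import Data.Vec.Relation.Unary.All as VAll
open import Data.Vec.Relation.Unary.All.Properties using (lookup⁺; lookup⁻)
open import Data.Vec.Properties using (lookup-replicate)
open import Function using (_∘_; _⇔_; mk⇔; Equivalence)
open import Data.Nat.Induction using (<-wellFounded)
open import Induction.WellFounded using (Acc; acc)
open import Relation.Binary.PropositionalEquality using (refl; sym)
open import Relation.Nullary using (Dec; yes; no; ¬_)
open import Relation.Nullary.Decidable using (map′)

T-not⁺ : ∀ {b} → ¬ T b → T (not b)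
T-not⁺ {false} _  = tt
T-not⁺ {true}  ¬t = ¬t tt

T-not⁻ : ∀ {b} → T (not b) → ¬ T b
T-not⁻ {false} _ ()

⇒ᵇ-elim : ∀ {a b} → T (a ⇒ᵇ b) → T a → T b
⇒ᵇ-elim {true} b _ = b

⇒ᵇ-intro : ∀ {a b} → (T a → T b) → T (a ⇒ᵇ b)
⇒ᵇ-intro {false} _ = tt
⇒ᵇ-intro {true}  f = f tt

all-allFin⁻ : ∀ {n} {p : Fin n → Bool} → T (all p (allFin n)) → ∀ k → T (p k)
all-allFin⁻ {p = p} h k = All.lookup (all⁺ p _ h) (∈-allFin k)

all-allFin⁺ : ∀ {n} {p : Fin n → Bool} → (∀ k → T (p k)) → T (all p (allFin n))
all-allFin⁺ {n} {p} h = all⁻ p {xs = allFin n} (All.tabulate (λ {k} _ → h k))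

satᵇ : ∀ {n} → Vec ℕ n → Eqn n → Bool
satᵇ x (one k)     = lookup x k ≡ᵇ 1
satᵇ x (add i j k) = lookup x i + lookup x j ≡ᵇ lookup x k
satᵇ x (mul i j k) = lookup x i * lookup x j ≡ᵇ lookup x k

T-satᵇ : ∀ {n} (x : Vec ℕ n) e → T (satᵇ x e) ⇔ Sat x e
T-satᵇ x (one k)     = mk⇔ (≡ᵇ⇒≡ _ _) (≡⇒≡ᵇ _ _)
T-satᵇ x (add i j k) = mk⇔ (≡ᵇ⇒≡ _ _) (≡⇒≡ᵇ _ _)
T-satᵇ x (mul i j k) = mk⇔ (≡ᵇ⇒≡ _ _) (≡⇒≡ᵇ _ _)

Sat? : ∀ {n} (x : Vec ℕ n) e → Dec (Sat x e)
Sat? x e = map′ (Equivalence.to (T-satᵇ x e)) (Equivalence.from (T-satᵇ x e)) (T? (satᵇ x e))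

Duplicate : ∀ {n} → Vec ℕ n → Vec ℕ n → Set
Duplicate x y = ∀ e → Sat x e → Sat y e

Duplicate-refl : ∀ {n} {x : Vec ℕ n} → Duplicate x x
Duplicate-refl e s = s

Duplicate-trans : ∀ {n} {x y z : Vec ℕ n} → Duplicate x y → Duplicate y z → Duplicate x z
Duplicate-trans x⇝y y⇝z e = y⇝z e ∘ x⇝y e

Duplicate-solves : ∀ {n} {x y : Vec ℕ n} {S} → Duplicate x y → Solves x S → Solves y S
Duplicate-solves x⇝y = All.map (λ {e} → x⇝y e)

module _ {n} (x y : Vec ℕ n) where

  preservesᵇ : Eqn n → Bool
  preservesᵇ e = satᵇ x e ⇒ᵇ satᵇ y e

  arithᵇ : Fin n → Fin n → Fin n → Bool
  arithᵇ i j k = preservesᵇ (add i j k) ∧ preservesᵇ (mul i j k)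

  isDuplicate⁻ : T (isDuplicate x y) → Duplicate x y
  isDuplicate⁻ h e =
    Equivalence.to (T-satᵇ y e) ∘ ⇒ᵇ-elim (preserved e) ∘ Equivalence.from (T-satᵇ x e)
    where
    parts : T (all (preservesᵇ ∘ one) (allFin n)) ×
            T (all (λ i → all (λ j → all (arithᵇ i j) (allFin n)) (allFin n)) (allFin n))
    parts = Equivalence.to T-∧ h
    arith : ∀ i j k → T (preservesᵇ (add i j k)) × T (preservesᵇ (mul i j k))
    arith i j k = Equivalence.to T-∧ (all-allFin⁻ (all-allFin⁻ (all-allFin⁻ (proj₂ parts) i) j) k)
    preserved : ∀ e → T (preservesᵇ e)
    preserved (one k)     = all-allFin⁻ (proj₁ parts) k
    preserved (add i j k) = proj₁ (arith i j k)
    preserved (mul i j k) = proj₂ (arith i j k)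

  isDuplicate⁺ : Duplicate x y → T (isDuplicate x y)
  isDuplicate⁺ x⇝y = Equivalence.from T-∧ (all-allFin⁺ (preserved ∘ one) ,
      all-allFin⁺ λ i → all-allFin⁺ λ j → all-allFin⁺ λ k →
        Equivalence.from T-∧ (preserved (add i j k) , preserved (mul i j k)))
    where
    preserved : ∀ e → T (preservesᵇ e)
    preserved e = ⇒ᵇ-intro (Equivalence.from (T-satᵇ y e) ∘ x⇝y e ∘ Equivalence.to (T-satᵇ x e))

≤-maxV : ∀ {n} (x : Vec ℕ n) → VAll.All (_≤ maxV x) x
≤-maxV []      = VAll.[]
≤-maxV (a ∷ x) = m≤m⊔n a (maxV x) VAll.∷ VAll.map (λ p → ≤-trans p (m≤n⊔m a (maxV x))) (≤-maxV x)

maxV-lub : ∀ {n c} {x : Vec ℕ n} → VAll.All (_≤ c) x → maxV x ≤ c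
maxV-lub VAll.[]         = z≤n
maxV-lub (a≤c VAll.∷ x≤c) = ⊔-lub a≤c (maxV-lub x≤c)

lookup≤maxV : ∀ {n} (x : Vec ℕ n) k → lookup x k ≤ maxV x
lookup≤maxV x = lookup⁺ (≤-maxV x)

tuples⁺ : ∀ {n m} {x : Vec ℕ n} → VAll.All (_< m) x → x ∈ tuples n m
tuples⁺ VAll.[]           = here refl
tuples⁺ {suc n} {m} (a<m VAll.∷ x<m) =
  ∈-concatMap⁺ (λ a → map (a ∷_) (tuples n m)) (lose (∈-upTo⁺ a<m) (∈-map⁺ _ (tuples⁺ x<m)))

tuples⁻ : ∀ {n m} {x : Vec ℕ n} → x ∈ tuples n m → VAll.All (_< m) x
tuples⁻ {x = []}    _   = VAll.[]
tuples⁻ {suc n} {m} {a ∷ x} x∈ with find (∈-concatMap⁻ (λ a → map (a ∷_) (tuples n m)) {xs = upTo m} x∈)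
... | _ , a′∈ , ∷∈ with ∈-map⁻ _ ∷∈
... | _ , x∈′ , refl = ∈-upTo⁻ a′∈ VAll.∷ tuples⁻ x∈′

maxV<⇒∈tuples : ∀ {n m} {x : Vec ℕ n} → maxV x < m → x ∈ tuples n m
maxV<⇒∈tuples {x = x} x<m = tuples⁺ (VAll.map (λ p → ≤-<-trans p x<m) (≤-maxV x))

∈tuples⇒maxV≤pred : ∀ {n m} {x : Vec ℕ n} → x ∈ tuples n m → maxV x ≤ m ∸ 1
∈tuples⇒maxV≤pred = maxV-lub ∘ VAll.map <⇒≤pred ∘ tuples⁻

Removable : ∀ {n} → Vec ℕ n → Set
Removable x = ∃[ y ] Duplicate x y × maxV y < maxV x

removable⇒Removable : ∀ {n m} {x : Vec ℕ n} → T (removable n m x) → Removable x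
removable⇒Removable {n} {m} {x} h with find (any⁻ _ (tuples n m) h)
... | y , _ , found with Equivalence.to (T-∧ {isDuplicate x y}) found
... | x⇝y , y<x = y , isDuplicate⁻ x y x⇝y , <ᵇ⇒< _ _ y<x

Removable⇒removable : ∀ {n m} {x : Vec ℕ n} → x ∈ tuples n m → Removable x → T (removable n m x)
Removable⇒removable {n} {m} {x} x∈ (y , x⇝y , y<x) =
  any⁺ _ (lose y∈ (Equivalence.from T-∧ (isDuplicate⁺ x y x⇝y , <⇒<ᵇ y<x)))
  where
  y∈ : y ∈ tuples n m
  y∈ = maxV<⇒∈tuples (<-≤-trans y<x (≤-trans (∈tuples⇒maxV≤pred x∈) (m∸n≤m m 1)))

-- Once x ∈ X_m^n, removability in X_m^n does not depend on m, so the Boolean test decides it.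
Removable? : ∀ {n} (x : Vec ℕ n) → Dec (Removable x)
Removable? {n} x = map′ removable⇒Removable (Removable⇒removable (maxV<⇒∈tuples (n<1+n (maxV x))))
                        (T? (removable n (suc (maxV x)) x))

nonRemovableDuplicate : ∀ {n} (x : Vec ℕ n) → ∃[ z ] Duplicate x z × maxV z ≤ maxV x × ¬ Removable z
nonRemovableDuplicate x = go x (<-wellFounded (maxV x))
  where
  go : ∀ x → Acc _<_ (maxV x) → ∃[ z ] Duplicate x z × maxV z ≤ maxV x × ¬ Removable z
  go x (acc rec) with Removable? x
  ... | no ¬removable = x , Duplicate-refl , ≤-refl , ¬removable
  ... | yes (y , x⇝y , y<x) with go y (rec y<x)
  ...   | z , y⇝z , z≤y , ¬removable = z , Duplicate-trans x⇝y y⇝z , ≤-trans z≤y (<⇒≤ y<x) , ¬removable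

foldr-⊔-lub : ∀ {c} {ns : List ℕ} → All (_≤ c) ns → foldr _⊔_ 0 ns ≤ c
foldr-⊔-lub All.[]          = z≤n
foldr-⊔-lub (n≤c All.∷ ns≤c) = ⊔-lub n≤c (foldr-⊔-lub ns≤c)

∈⇒≤foldr-⊔ : ∀ {n} {ns : List ℕ} → n ∈ ns → n ≤ foldr _⊔_ 0 ns
∈⇒≤foldr-⊔ (here refl) = m≤m⊔n _ _
∈⇒≤foldr-⊔ (there n∈) = ≤-trans (∈⇒≤foldr-⊔ n∈) (m≤n⊔m _ _)

g-lub : ∀ n m {c} → (∀ {x} → x ∈ tuples n m → ¬ Removable x → maxV x ≤ c) → g n m ≤ c
g-lub n m bound = foldr-⊔-lub (map⁺ (All.tabulate λ x∈ →
  let x∈tuples , kept = ∈-filter⁻ (T? ∘ (not ∘ removable n m)) x∈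
  in bound x∈tuples (T-not⁻ kept ∘ Removable⇒removable x∈tuples)))

maxV≤g : ∀ n m {x : Vec ℕ n} → x ∈ tuples n m → ¬ Removable x → maxV x ≤ g n m
maxV≤g n m x∈ ¬removable = ∈⇒≤foldr-⊔ (∈-map⁺ maxV
  (∈-filter⁺ (T? ∘ (not ∘ removable n m)) x∈ (T-not⁺ (¬removable ∘ removable⇒Removable))))

arithEqns : ∀ {n} → Fin n → Fin n → Fin n → List (Eqn n)
arithEqns i j k = add i j k ∷ mul i j k ∷ []

allEqns : ∀ n → List (Eqn n)
allEqns n = map one (allFin n) ++
  concatMap (λ i → concatMap (λ j → concatMap (arithEqns i j) (allFin n)) (allFin n)) (allFin n)

arithEqns⊆allEqns : ∀ {n} i j k {e : Eqn n} → e ∈ arithEqns i j k → e ∈ allEqns n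
arithEqns⊆allEqns {n} i j k e∈ = ∈-++⁺ʳ (map one (allFin n))
  (∈-concatMap⁺ _ (lose (∈-allFin i)
    (∈-concatMap⁺ _ (lose (∈-allFin j)
      (∈-concatMap⁺ _ (lose (∈-allFin k) e∈))))))

∈-allEqns : ∀ {n} (e : Eqn n) → e ∈ allEqns n
∈-allEqns (one k)     = ∈-++⁺ˡ (∈-map⁺ one (∈-allFin k))
∈-allEqns (add i j k) = arithEqns⊆allEqns i j k (here refl)
∈-allEqns (mul i j k) = arithEqns⊆allEqns i j k (there (here refl))

satisfiedEqns : ∀ {n} → Vec ℕ n → List (Eqn n)
satisfiedEqns {n} x = filter (Sat? x) (allEqns n)

solves-satisfiedEqns⇒Duplicate : ∀ {n} {x y : Vec ℕ n} → Solves y (satisfiedEqns x) → Duplicate x y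
solves-satisfiedEqns⇒Duplicate {x = x} solves e s = All.lookup solves (∈-filter⁺ (Sat? x) (∈-allEqns e) s)

BoundedDuplicates : ℕ → ℕ → Set
BoundedDuplicates n b = (x : Vec ℕ n) → ∃[ y ] Duplicate x y × maxV y ≤ b

Bounds⇒BoundedDuplicates : ∀ {n b} → Bounds n b → BoundedDuplicates n b
Bounds⇒BoundedDuplicates bounds x with bounds (satisfiedEqns x) (x , all-filter (Sat? x) (allEqns _))
... | y , solves , y≤b = y , solves-satisfiedEqns⇒Duplicate solves , maxV-lub y≤b

BoundedDuplicates⇒Bounds : ∀ {n b} → BoundedDuplicates n b → Bounds n b
BoundedDuplicates⇒Bounds dups S (x , solves) with dups x
... | y , x⇝y , y≤b = y , Duplicate-solves x⇝y solves , VAll.map (λ p → ≤-trans p y≤b) (≤-maxV y)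

ones≤1 : ∀ {n} → VAll.All (_≤ 1) (replicate n 1)
ones≤1 = lookup⁻ λ k → ≤-reflexive (lookup-replicate k 1)

Duplicate-ones⇒1≤maxV : ∀ {n} {y : Vec ℕ (suc n)} → Duplicate (replicate (suc n) 1) y → 1 ≤ maxV y
Duplicate-ones⇒1≤maxV {y = y} ones⇝y =
  ≤-trans (≤-reflexive (sym (ones⇝y (one Fin.zero) refl))) (lookup≤maxV y Fin.zero)

ones-nonRemovable : ∀ {n} → ¬ Removable (replicate (suc n) 1)
ones-nonRemovable {n} (y , ones⇝y , y<ones) =
  <⇒≱ (<-≤-trans y<ones (maxV-lub (ones≤1 {suc n}))) (Duplicate-ones⇒1≤maxV {n} ones⇝y)

Bounds⇒1≤ : ∀ {n b} → Bounds (suc n) b → 1 ≤ b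
Bounds⇒1≤ bounds with Bounds⇒BoundedDuplicates bounds (replicate _ 1)
... | y , ones⇝y , y≤b = ≤-trans (Duplicate-ones⇒1≤maxV ones⇝y) y≤b

g≤pred : ∀ n m → g n m ≤ m ∸ 1
g≤pred n m = g-lub n m λ x∈ _ → ∈tuples⇒maxV≤pred x∈

g<m : ∀ n m .{{_ : NonZero m}} → g n m < m
g<m n m = m≤pred[n]⇒suc[m]≤n (g≤pred n m)

g[n,2]≡1 : ∀ n → g (suc n) 2 ≡ 1
g[n,2]≡1 n = ≤-antisym (g≤pred (suc n) 2)
  (≤-trans (Duplicate-ones⇒1≤maxV {n} Duplicate-refl) (maxV≤g (suc n) 2 ones∈ ones-nonRemovable))
  where
  ones∈ : replicate (suc n) 1 ∈ tuples (suc n) 2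
  ones∈ = tuples⁺ (VAll.map s≤s ones≤1)

g-mono : ∀ n {m m′} → m ≤ m′ → g n m ≤ g n m′
g-mono n {m} {m′} m≤m′ = g-lub n m λ x∈ ¬removable →
  maxV≤g n m′ (tuples⁺ (VAll.map (λ p → <-≤-trans p m≤m′) (tuples⁻ x∈))) ¬removable

g≤bound : ∀ {n b} m → Bounds n b → g n m ≤ b
g≤bound {n} m bounds = g-lub n m λ {x} _ ¬removable →
  let y , x⇝y , y≤b = Bounds⇒BoundedDuplicates bounds x
  in ≮⇒≥ λ b<x → ¬removable (y , x⇝y , ≤-<-trans y≤b b<x)

Bounds-g : ∀ {n b m} → Bounds n b → b < m → Bounds n (g n m)
Bounds-g {n} {m = m} bounds b<m = BoundedDuplicates⇒Bounds λ x →
  let y , x⇝y , y≤b = Bounds⇒BoundedDuplicates bounds x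
      z , y⇝z , z≤y , ¬removable = nonRemovableDuplicate y
  in z , Duplicate-trans x⇝y y⇝z ,
     maxV≤g n m (maxV<⇒∈tuples (≤-<-trans (≤-trans z≤y y≤b) b<m)) ¬removable

g≡f : ∀ {n b m} → IsF n b → b < m → g n m ≡ b
g≡f {m = m} (bounds , minimal) b<m = ≤-antisym (g≤bound m bounds) (minimal _ (Bounds-g bounds b<m))

theorem2 : (n : ℕ) → 1 ≤ n →
    ((m : ℕ) → 1 ≤ m → g n m ≤ m ∸ 1) ×
    (g n 1 ≡ 0) × (g n 2 ≡ 1) ×
    ((m : ℕ) → 2 ≤ m → g n m ≤ g n (suc m)) ×
    ((b : ℕ) → IsF n b → (g n b < b) × ((k : ℕ) → g n (b + suc k) ≡ b))
theorem2 n@(suc n′) _ =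
  (λ m _ → g≤pred n m) ,
  n≤0⇒n≡0 (g≤pred n 1) ,
  g[n,2]≡1 n′ ,
  (λ m _ → g-mono n (n≤1+n m)) ,
  λ b isF → g<m n b {{>-nonZero (Bounds⇒1≤ (proj₁ isF))}} ,
            λ k → g≡f isF (m<m+n b (s≤s z≤n))
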